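{- Let $k\ge 2$ and let $S=(s_1,s_2,\ldots)$ be a packing sequence with $s_2\ge 2$. Then there exists a tree $T$ that is $k$-$\chi_S$-critical.
   Context: A packing sequence is a non-decreasing sequence $S=(s_1,s_2,\ldots)$ of positive integers other than the constant sequence $(1,1,\ldots)$. An $S$-packing $k$-coloring of a graph $G$ is a map $c:V(G)\to\{1,\ldots,k\}$ such that whenever $u\neq v$ and $c(u)=c(v)=i$, the shortest-path distance satisfies $d_G(u,v)>s_i$. The $S$-packing chromatic number $\chi_S(G)$ is the least $k$ such that $G$ admits an $S$-packing $k$-coloring. A graph $G$ is $k$-$\chi_S$-critical if $\chi_S(G)=k$ and $\chi_S(G-u)<\chi_S(G)$ for every $u\in V(G)$. -}

module Defs where

open import Data.Nat using (ℕ; zero; suc; _≤_; _<_; _+_)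
open import Data.Fin using (Fin; toℕ; punchIn; inject₁; fromℕ)
open import Data.Product using (Σ; ∃; _×_; _,_)
open import Relation.Binary.PropositionalEquality using (_≡_; _≢_)
open import Relation.Nullary using (¬_)
open import Function.Definitions using (Injective)

record Graph (n : ℕ) : Set₁ where
  field
    Adj     : Fin n → Fin n → Set
    sym     : ∀ {u v} → Adj u v → Adj v u
    irrefl  : ∀ {u} → ¬ Adj u u
open Graph public

data Walk {n : ℕ} (G : Graph n) : Fin n → Fin n → ℕ → Set where
  here : ∀ {u} → Walk G u u 0
  step : ∀ {u w v l} → Adj G u w → Walk G w v l → Walk G u v (suc l)

-- d_G(u,v) ≤ m  (shortest walk length = shortest path length);
-- d_G(u,v) > m is its negation (also covers d = ∞).
DistLe : ∀ {n} → Graph n → Fin n → Fin n → ℕ → Set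
DistLe G u v m = ∃ λ l → l ≤ m × Walk G u v l

-- Packing sequence S = (s 1, s 2, ...); the value s 0 is ignored.
record PackingSequence (s : ℕ → ℕ) : Set where
  field
    positive     : ∀ i → 1 ≤ s (suc i)
    nondecr      : ∀ i → s (suc i) ≤ s (suc (suc i))
    nonconstant  : ∃ λ i → s (suc i) ≢ 1

-- S-packing k-coloring; color j : Fin k stands for color (toℕ j + 1).
IsSPackingColoring : (s : ℕ → ℕ) → ∀ {n} → Graph n → (k : ℕ) → (Fin n → Fin k) → Set
IsSPackingColoring s G k c =
  ∀ u v → u ≢ v → c u ≡ c v → ¬ DistLe G u v (s (suc (toℕ (c u))))

SColorable : (s : ℕ → ℕ) → ∀ {n} → Graph n → ℕ → Set
SColorable s {n} G k = Σ (Fin n → Fin k) λ c → IsSPackingColoring s G k c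

ChiSIs : (s : ℕ → ℕ) → ∀ {n} → Graph n → ℕ → Set
ChiSIs s G k = SColorable s G k × (∀ j → j < k → ¬ SColorable s G j)

deleteVertex : ∀ {n} → Graph (suc n) → Fin (suc n) → Graph n
deleteVertex G u = record
  { Adj    = λ a b → Adj G (punchIn u a) (punchIn u b)
  ; sym    = sym G
  ; irrefl = irrefl G }

IsCritical : (s : ℕ → ℕ) → ∀ {n} → Graph (suc n) → ℕ → Set
IsCritical s {n} G k =
  ChiSIs s G k ×
  (∀ (u : Fin (suc n)) → ∃ λ j → j < k × ChiSIs s (deleteVertex G u) j)

Connected : ∀ {n} → Graph n → Set
Connected {n} G = ∀ (u v : Fin n) → ∃ λ l → Walk G u v l

HasCycle : ∀ {n} → Graph n → Set
HasCycle {n} G = ∃ λ m → Σ (Fin (3 + m) → Fin n) λ f →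
  Injective _≡_ _≡_ f ×
  (∀ (i : Fin (2 + m)) → Adj G (f (inject₁ i)) (f (Data.Fin.suc i))) ×
  Adj G (f (fromℕ (2 + m))) (f Data.Fin.zero)

IsTree : ∀ {n} → Graph n → Set
IsTree G = Connected G × ¬ HasCycle G

-- Let m = k − 1 and let T₀ be the complete m-ary tree of depth 2. The m children of a vertex are
-- pairwise at distance 2, and a color i ≥ 2 cannot repeat at distance 2 because s_i ≥ s₂ ≥ 2; so by
-- pigeonhole one of them has color 1 in any S-packing m-coloring. Hence some child of the root has
-- color 1, and so does one of its own children, contradicting s₁ ≥ 1: T₀ is not m-colorable.
-- Deleting vertices of T₀ while the graph stays non-m-colorable ends in an induced subgraph T all of
-- whose vertex-deleted subgraphs are m-colorable. Such a T is connected, since otherwise its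
-- components could be colored separately. Every vertex of T₀ has at most one neighbour of smaller
-- index (its parent), so T is acyclic and its vertex of largest index is a leaf; giving that leaf a
-- fresh color extends an m-coloring of the rest, so χ_S(T) = m + 1 = k and T is k-χ_S-critical.
module Submission where

open import Defs
open import Data.Nat using (ℕ; zero; suc; _≤_; _<_; z≤n; s≤s; _+_; _*_)
open import Data.Nat.Properties
  using (≤-refl; ≤-trans; ≤-pred; <-≤-trans; m≤n⇒m≤1+n; m≤n⇒m<n∨m≡n; m≤m+n; n<1+n; <-irrefl;
         anyUpTo?; _≤?_; ≰⇒>; <⇒≤; _≟_; module ≤-Reasoning)
open import Data.Fin as Fin
  using (Fin; toℕ; punchIn; punchOut; inject₁; inject≤; fromℕ; _↑ˡ_; _↑ʳ_; splitAt; combine;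
         remQuot)
open import Data.Fin.Properties
  using (any?; all?; pigeonhole; punchIn-injective; punchIn-punchOut; punchOut-injective;
         toℕ-injective; toℕ<n; toℕ-inject₁; toℕ-inject≤; inject≤-injective; inject₁-injective;
         fromℕ≢inject₁; toℕ-↑ˡ; toℕ-↑ʳ; ↑ˡ-injective; ↑ʳ-injective; splitAt-↑ˡ; splitAt-↑ʳ;
         remQuot-combine; combine-injectiveʳ; suc-injective; <⇒≢; ≤̄⇒inject₁<; _<?_)
open import Data.Vec.Functional using (_∷_; head; tail)
open import Data.Product using (Σ; ∃; ∃₂; _×_; _,_; proj₁)
open import Data.Sum using (_⊎_; inj₁; inj₂; [_,_]′)
open import Data.Empty using (⊥-elim)
open import Function using (_∘_; id)
open import Function.Definitions using (Injective)
open import Relation.Nullary using (¬_; Dec; yes; no)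
open import Relation.Nullary.Decidable using (_×-dec_; _⊎-dec_; _→-dec_; ¬?; map′; decidable-stable)
open import Relation.Binary.PropositionalEquality as ≡
  using (_≡_; _≢_; refl; cong; subst; subst₂; module ≡-Reasoning)

DecidableAdj : ∀ {n} → Graph n → Set
DecidableAdj {n} G = ∀ (u v : Fin n) → Dec (Adj G u v)

module _ {n} {G : Graph n} (adj? : DecidableAdj G) where

  walk? : ∀ u v l → Dec (Walk G u v l)
  walk? u v zero with u Fin.≟ v
  ... | yes refl = yes here
  ... | no u≢v   = no λ { here → u≢v refl }
  walk? u v (suc l) =
    map′ (λ (w , a , r) → step a r) (λ { (step a r) → _ , a , r })
         (any? λ w → adj? u w ×-dec walk? w v l)

  distLe? : ∀ u v m → Dec (DistLe G u v m)
  distLe? u v m =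
    map′ (λ (l , l<1+m , w) → l , ≤-pred l<1+m , w) (λ (l , l≤m , w) → l , s≤s l≤m , w)
         (anyUpTo? (walk? u v) (suc m))

  isSPackingColoring? : ∀ s k c → Dec (IsSPackingColoring s G k c)
  isSPackingColoring? s k c = all? λ u → all? λ v →
    ¬? (u Fin.≟ v) →-dec (c u Fin.≟ c v →-dec ¬? (distLe? u v _))

∃-function? : ∀ n j (Q : (Fin n → Fin j) → Set) → (∀ c → Dec (Q c)) →
  (∀ {c c′} → (∀ x → c x ≡ c′ x) → Q c → Q c′) → Dec (Σ (Fin n → Fin j) Q)
∃-function? zero j Q Q? Q-resp =
  map′ (λ q → empty , q) (λ (c , q) → Q-resp {c} (λ ()) q) (Q? empty)
  where
  empty : Fin 0 → Fin j
  empty ()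
∃-function? (suc n) j Q Q? Q-resp =
  map′ (λ (a , c , q) → a ∷ c , q) (λ (c , q) → head c , tail c , Q-resp head∷tail q)
       (any? λ a → ∃-function? n j (Q ∘ (a ∷_)) (Q? ∘ (a ∷_)) (λ c≗c′ → Q-resp (cons-cong c≗c′)))
  where
  head∷tail : ∀ {c : Fin (suc n) → Fin j} x → c x ≡ (head c ∷ tail c) x
  head∷tail Fin.zero    = refl
  head∷tail (Fin.suc x) = refl
  cons-cong : ∀ {a} {c c′ : Fin n → Fin j} → (∀ x → c x ≡ c′ x) → ∀ x → (a ∷ c) x ≡ (a ∷ c′) x
  cons-cong c≗c′ Fin.zero    = refl
  cons-cong c≗c′ (Fin.suc x) = c≗c′ x

module _ (s : ℕ → ℕ) {n} {G : Graph n} where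

  isSPackingColoring-resp-≗ : ∀ {k} {c c′ : Fin n → Fin k} → (∀ x → c x ≡ c′ x) →
    IsSPackingColoring s G k c → IsSPackingColoring s G k c′
  isSPackingColoring-resp-≗ c≗c′ h u v u≢v c′u≡c′v =
    subst (λ i → ¬ DistLe G u v (s (suc (toℕ i)))) (c≗c′ u)
      (h u v u≢v (≡.trans (c≗c′ u) (≡.trans c′u≡c′v (≡.sym (c≗c′ v)))))

  sColorable? : DecidableAdj G → ∀ j → Dec (SColorable s G j)
  sColorable? adj? j =
    ∃-function? n j _ (isSPackingColoring? adj? s j) isSPackingColoring-resp-≗

  sColorable-mono : ∀ {j j′} → j ≤ j′ → SColorable s G j → SColorable s G j′
  sColorable-mono j≤j′ (c , h) = (λ x → inject≤ (c x) j≤j′) , λ u v u≢v cu≡cv →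
    subst (λ t → ¬ DistLe G u v (s (suc t))) (≡.sym (toℕ-inject≤ (c u) j≤j′))
      (h u v u≢v (inject≤-injective j≤j′ j≤j′ (c u) (c v) cu≡cv))

  chiSIs-suc : ∀ {j} → SColorable s G (suc j) → ¬ SColorable s G j → ChiSIs s G (suc j)
  chiSIs-suc col ¬col = col , λ i i<1+j col-i → ¬col (sColorable-mono (≤-pred i<1+j) col-i)

  chiSIs-≤ : DecidableAdj G → ∀ {j} → SColorable s G j → ∃ λ i → i ≤ j × ChiSIs s G i
  chiSIs-≤ adj? {zero} col = 0 , z≤n , col , λ _ ()
  chiSIs-≤ adj? {suc j} col with sColorable? adj? j
  ... | yes col-j = let (i , i≤j , χ) = chiSIs-≤ adj? col-j in i , m≤n⇒m≤1+n i≤j , χ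
  ... | no ¬col-j = suc j , ≤-refl , chiSIs-suc col ¬col-j

  adjacent-colors-differ : PackingSequence s → ∀ {k c} → IsSPackingColoring s G k c →
    ∀ {u v} → Adj G u v → c u ≢ c v
  adjacent-colors-differ S h {u} {v} a cu≡cv =
    h u v (λ { refl → irrefl G a }) cu≡cv (1 , PackingSequence.positive S _ , step a here)

module _ {s : ℕ → ℕ} (S : PackingSequence s) (2≤s₂ : 2 ≤ s 2) where

  2≤s[2+t] : ∀ t → 2 ≤ s (2 + t)
  2≤s[2+t] zero    = 2≤s₂
  2≤s[2+t] (suc t) = ≤-trans (2≤s[2+t] t) (PackingSequence.nondecr S (suc t))

  -- Fin.zero encodes the paper's color 1, the only color with possibly s_i < 2.
  sameColor-atDistance2⇒color₀ : ∀ {n} {G : Graph n} {k c} → IsSPackingColoring s G (suc k) c →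
    ∀ {x y} → x ≢ y → Walk G x y 2 → c x ≡ c y → c x ≡ Fin.zero
  sameColor-atDistance2⇒color₀ {c = c} h {x} {y} x≢y w cx≡cy with c x Fin.≟ Fin.zero
  ... | yes cx≡0 = cx≡0
  ... | no cx≢0  = ⊥-elim (h x y x≢y cx≡cy (2 , 2≤s[1+toℕ] (c x) cx≢0 , w))
    where
    2≤s[1+toℕ] : ∀ {k} (i : Fin (suc k)) → i ≢ Fin.zero → 2 ≤ s (suc (toℕ i))
    2≤s[1+toℕ] Fin.zero    0≢0 = ⊥-elim (0≢0 refl)
    2≤s[1+toℕ] (Fin.suc i) _   = 2≤s[2+t] (toℕ i)

  module _ {n} {G : Graph n} {k c} (h : IsSPackingColoring s G (suc k) c)
    {z} (W : Fin (suc k) → Fin n) (W-inj : Injective _≡_ _≡_ W) (z~W : ∀ a → Adj G z (W a)) where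

    private
      leaves-atDistance2 : ∀ a b → Walk G (W a) (W b) 2
      leaves-atDistance2 a b = step (sym G (z~W a)) (step (z~W b) here)

      -- punchOut maps the colors other than Fin.zero injectively into Fin k.
      ¬allLeaves-color≢₀ : ¬ (∀ a → Fin.zero ≢ c (W a))
      ¬allLeaves-color≢₀ nonzero with pigeonhole (n<1+n k) (λ a → punchOut (nonzero a))
      ... | a , b , a<b , same =
        nonzero a (≡.sym (sameColor-atDistance2⇒color₀ h (<⇒≢ a<b ∘ W-inj) (leaves-atDistance2 a b)
                                                        (punchOut-injective (nonzero a) (nonzero b) same)))

    star-hasColor₀ : ∃ λ a → c (W a) ≡ Fin.zero
    star-hasColor₀ with any? (λ a → c (W a) Fin.≟ Fin.zero)
    ... | yes found = found
    ... | no none   = ⊥-elim (¬allLeaves-color≢₀ λ a 0≡c → none (a , ≡.sym 0≡c))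

_++ᵂ_ : ∀ {n} {G : Graph n} {a b c l l′} → Walk G a b l → Walk G b c l′ → Walk G a c (l + l′)
here     ++ᵂ r′ = r′
step x r ++ᵂ r′ = step x (r ++ᵂ r′)

module _ {n} (G : Graph n) where

  Closed : (Fin n → Set) → Set
  Closed Q = ∀ {a b} → Adj G a b → Q a → Q b

  closed-walk : ∀ {Q} → Closed Q → ∀ {a b l} → Walk G a b l → Q a → Q b
  closed-walk Q-closed here       q = q
  closed-walk Q-closed (step x r) q = closed-walk Q-closed r (Q-closed x q)

  closed-complement : ∀ {Q} → Closed Q → Closed (¬_ ∘ Q)
  closed-complement Q-closed a ¬qa qb = ¬qa (Q-closed (sym G a) qb)


walk-deleteVertex : ∀ {n} (G : Graph (suc n)) {v} {Q} → Closed G Q → (∀ {a} → Q a → v ≢ a) →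
  ∀ {a b l a′ b′} → Walk G a b l → Q a → punchIn v a′ ≡ a → punchIn v b′ ≡ b →
  Walk (deleteVertex G v) a′ b′ l
walk-deleteVertex G {v} _ _ {a′ = a′} {b′} here _ a′↦a b′↦b =
  subst (λ x → Walk (deleteVertex G v) a′ x 0)
        (punchIn-injective v a′ b′ (≡.trans a′↦a (≡.sym b′↦b))) here
walk-deleteVertex G Q-closed Q⇒≢v (step x r) qa a′↦a b′↦b =
  step (subst₂ (Adj G) (≡.sym a′↦a) (≡.sym (punchIn-punchOut v≢w)) x)
       (walk-deleteVertex G Q-closed Q⇒≢v r qw (punchIn-punchOut v≢w) b′↦b)
  where
  qw = Q-closed x qa
  v≢w = Q⇒≢v qw

module Reachability {n} {G : Graph n} (adj? : DecidableAdj G) where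

  -- Floyd–Warshall: a walk from a to b all of whose inner vertices have index < t.
  ReachVia : ℕ → Fin n → Fin n → Set
  ReachVia zero    a b = a ≡ b ⊎ Adj G a b
  ReachVia (suc t) a b = ReachVia t a b ⊎ ∃ λ w → toℕ w ≡ t × ReachVia t a w × ReachVia t w b

  Reachable : Fin n → Fin n → Set
  Reachable = ReachVia n

  reachVia? : ∀ t a b → Dec (ReachVia t a b)
  reachVia? zero    a b = a Fin.≟ b ⊎-dec adj? a b
  reachVia? (suc t) a b = reachVia? t a b ⊎-dec
    any? (λ w → toℕ w ≟ t ×-dec reachVia? t a w ×-dec reachVia? t w b)

  reachable? : ∀ a b → Dec (Reachable a b)
  reachable? = reachVia? n

  reachVia⇒walk : ∀ t {a b} → ReachVia t a b → ∃ λ l → Walk G a b l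
  reachVia⇒walk zero    (inj₁ refl) = 0 , here
  reachVia⇒walk zero    (inj₂ x)    = 1 , step x here
  reachVia⇒walk (suc t) (inj₁ r)    = reachVia⇒walk t r
  reachVia⇒walk (suc t) (inj₂ (w , _ , r₁ , r₂)) =
    let (l₁ , w₁) = reachVia⇒walk t r₁ ; (l₂ , w₂) = reachVia⇒walk t r₂ in
    l₁ + l₂ , w₁ ++ᵂ w₂

  reachable⇒walk : ∀ {a b} → Reachable a b → ∃ λ l → Walk G a b l
  reachable⇒walk = reachVia⇒walk n

  reachVia-base : ∀ t {a b} → ReachVia 0 a b → ReachVia t a b
  reachVia-base zero    r = r
  reachVia-base (suc t) r = inj₁ (reachVia-base t r)

  private
    index-unique : ∀ {t} {w w′ : Fin n} → toℕ w ≡ t → toℕ w′ ≡ t → w ≡ w′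
    index-unique w↦t w′↦t = toℕ-injective (≡.trans w↦t (≡.sym w′↦t))

    -- A walk ending (or starting) at vertex t does not need t as an inner vertex.
    ending-at : ∀ {t a w} → toℕ w ≡ t → ReachVia (suc t) a w → ReachVia t a w
    ending-at w↦t (inj₁ r) = r
    ending-at {t} {a} w↦t (inj₂ (w′ , w′↦t , r₁ , _)) =
      subst (ReachVia t a) (index-unique w′↦t w↦t) r₁

    starting-at : ∀ {t w b} → toℕ w ≡ t → ReachVia (suc t) w b → ReachVia t w b
    starting-at w↦t (inj₁ r) = r
    starting-at {t} {b = b} w↦t (inj₂ (w′ , w′↦t , _ , r₂)) =
      subst (λ x → ReachVia t x b) (index-unique w′↦t w↦t) r₂

  reachVia-trans : ∀ t {a b c} → toℕ b < t → ReachVia t a b → ReachVia t b c → ReachVia t a c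
  reachVia-trans (suc t) {a} {b} {c} b<1+t r₁ r₂ with m≤n⇒m<n∨m≡n (≤-pred b<1+t)
  ... | inj₂ b↦t = inj₂ (b , b↦t , ending-at b↦t r₁ , starting-at b↦t r₂)
  ... | inj₁ b<t = join r₁ r₂
    where
    join : ReachVia (suc t) a b → ReachVia (suc t) b c → ReachVia (suc t) a c
    join (inj₁ r₁) (inj₁ r₂) = inj₁ (reachVia-trans t b<t r₁ r₂)
    join (inj₁ r₁) (inj₂ (w , w↦t , r₂ , r₃)) = inj₂ (w , w↦t , reachVia-trans t b<t r₁ r₂ , r₃)
    join (inj₂ (w , w↦t , r₁ , r₂)) (inj₁ r₃) = inj₂ (w , w↦t , r₁ , reachVia-trans t b<t r₂ r₃)
    join (inj₂ (w , w↦t , r₁ , _)) (inj₂ (w′ , w′↦t , _ , r₂)) =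
      inj₂ (w , w↦t , r₁ , subst (λ x → ReachVia t x c) (index-unique w′↦t w↦t) r₂)

  reachable-refl : ∀ {a} → Reachable a a
  reachable-refl = reachVia-base n (inj₁ refl)

  reachable-closed : ∀ {a} → Closed G (Reachable a)
  reachable-closed x r = reachVia-trans n (toℕ<n _) r (reachVia-base n (inj₂ x))

module _ (s : ℕ → ℕ) {n} {G : Graph (suc n)} where

  glue-colorings : ∀ {Q : Fin (suc n) → Set} → (∀ x → Dec (Q x)) → Closed G Q →
    ∀ {u v} → Q u → ¬ Q v → ∀ {j} →
    SColorable s (deleteVertex G v) j → SColorable s (deleteVertex G u) j → SColorable s G j
  glue-colorings {Q} Q? Q-closed {u} {v} qu ¬qv {j} (c₁ , h₁) (c₂ , h₂) =
    (λ x → color x (Q? x)) , λ a b a≢b ca≡cb → separated a b a≢b (Q? a) (Q? b) ca≡cb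
    where
    Q⇒≢v : ∀ {x} → Q x → v ≢ x
    Q⇒≢v qx refl = ¬qv qx
    ¬Q⇒≢u : ∀ {x} → ¬ Q x → u ≢ x
    ¬Q⇒≢u ¬qx refl = ¬qx qu
    color : ∀ x → Dec (Q x) → Fin j
    color x (yes qx)  = c₁ (punchOut (Q⇒≢v qx))
    color x (no ¬qx) = c₂ (punchOut (¬Q⇒≢u ¬qx))
    separated : ∀ a b → a ≢ b → (qa : Dec (Q a)) (qb : Dec (Q b)) → color a qa ≡ color b qb →
      ¬ DistLe G a b (s (suc (toℕ (color a qa))))
    separated a b a≢b (yes qa) (yes qb) ca≡cb (l , l≤ , w) =
      h₁ _ _ (a≢b ∘ punchOut-injective (Q⇒≢v qa) (Q⇒≢v qb)) ca≡cb
        (l , l≤ , walk-deleteVertex G Q-closed Q⇒≢v w qa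
                    (punchIn-punchOut (Q⇒≢v qa)) (punchIn-punchOut (Q⇒≢v qb)))
    separated a b a≢b (no ¬qa) (no ¬qb) ca≡cb (l , l≤ , w) =
      h₂ _ _ (a≢b ∘ punchOut-injective (¬Q⇒≢u ¬qa) (¬Q⇒≢u ¬qb)) ca≡cb
        (l , l≤ , walk-deleteVertex G (closed-complement G Q-closed) ¬Q⇒≢u w ¬qa
                    (punchIn-punchOut (¬Q⇒≢u ¬qa)) (punchIn-punchOut (¬Q⇒≢u ¬qb)))
    separated a b _ (yes qa) (no ¬qb) _ (_ , _ , w) = ¬qb (closed-walk G Q-closed w qa)
    separated a b _ (no ¬qa) (yes qb) _ (_ , _ , w) = closed-walk G (closed-complement G Q-closed) w ¬qa qb

  module _ (adj? : DecidableAdj G) where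
    open Reachability {G = G} adj?

    critical⇒connected : ∀ {j} → ¬ SColorable s G j → (∀ u → SColorable s (deleteVertex G u) j) →
      Connected G
    critical⇒connected ¬col col-del u v with reachable? u v
    ... | yes r = reachable⇒walk r
    ... | no ¬r =
      ⊥-elim (¬col (glue-colorings (reachable? u) reachable-closed reachable-refl ¬r
                                   (col-del v) (col-del u)))

AtMostOneNeighbour : ∀ {n} → Graph n → Fin n → Set
AtMostOneNeighbour G u = ∀ {a b} → Adj G u a → Adj G u b → a ≡ b

module _ {n} (G : Graph (suc n)) (u : Fin (suc n)) (pendant : AtMostOneNeighbour G u) where

  -- A walk through a vertex of degree ≤ 1 immediately returns, so the detour can be cut out.
  walk-avoiding-pendant : ∀ {x y l x′ y′} → Walk G x y l → u ≢ y →
    punchIn u x′ ≡ x → punchIn u y′ ≡ y → ∃ λ l′ → l′ ≤ l × Walk (deleteVertex G u) x′ y′ l′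
  walk-avoiding-pendant {x′ = x′} {y′} here _ x′↦x y′↦y =
    0 , z≤n , subst (λ z → Walk (deleteVertex G u) x′ z 0)
                    (punchIn-injective u x′ y′ (≡.trans x′↦x (≡.sym y′↦y))) here
  walk-avoiding-pendant (step {w = w} x r) u≢y x′↦x y′↦y with u Fin.≟ w
  walk-avoiding-pendant (step x r) u≢y x′↦x y′↦y | no u≢w =
    let (l′ , l′≤ , r′) = walk-avoiding-pendant r u≢y (punchIn-punchOut u≢w) y′↦y in
    suc l′ , s≤s l′≤ , step (subst₂ (Adj G) (≡.sym x′↦x) (≡.sym (punchIn-punchOut u≢w)) x) r′
  walk-avoiding-pendant (step x here) u≢y _ _ | yes refl = ⊥-elim (u≢y refl)
  walk-avoiding-pendant (step x (step y r)) u≢y x′↦x y′↦y | yes refl with pendant (sym G x) y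
  ... | refl =
    let (l′ , l′≤ , r′) = walk-avoiding-pendant r u≢y x′↦x y′↦y in
    l′ , m≤n⇒m≤1+n (m≤n⇒m≤1+n l′≤) , r′

  sColorable-extend-pendant : ∀ s {j} → SColorable s (deleteVertex G u) j → SColorable s G (suc j)
  sColorable-extend-pendant s {j} (c , h) =
    (λ x → color x (u Fin.≟ x)) , λ a b a≢b ca≡cb → separated a b a≢b (u Fin.≟ a) (u Fin.≟ b) ca≡cb
    where
    color : ∀ x → Dec (u ≡ x) → Fin (suc j)
    color x (yes _)  = fromℕ j
    color x (no u≢x) = inject₁ (c (punchOut u≢x))
    separated : ∀ a b → a ≢ b → (ua : Dec (u ≡ a)) (ub : Dec (u ≡ b)) → color a ua ≡ color b ub →
      ¬ DistLe G a b (s (suc (toℕ (color a ua))))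
    separated a b a≢b (yes refl) (yes refl) _ _ = a≢b refl
    separated a b _   (yes _)    (no _)     ca≡cb _ = fromℕ≢inject₁ ca≡cb
    separated a b _   (no _)     (yes _)    ca≡cb _ = fromℕ≢inject₁ (≡.sym ca≡cb)
    separated a b a≢b (no u≢a)   (no u≢b)   ca≡cb (l , l≤ , w) =
      let (l′ , l′≤l , w′) = walk-avoiding-pendant w u≢b (punchIn-punchOut u≢a) (punchIn-punchOut u≢b) in
      h _ _ (a≢b ∘ punchOut-injective u≢a u≢b) (inject₁-injective ca≡cb)
        (l′ , subst (λ t → l′ ≤ s (suc t)) (toℕ-inject₁ (c (punchOut u≢a))) (≤-trans l′≤l l≤) , w′)

private
  lastOrInject₁ : ∀ {n} (i : Fin (suc n)) → i ≡ fromℕ n ⊎ ∃ λ i′ → i ≡ inject₁ i′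
  lastOrInject₁ {zero}  Fin.zero    = inj₁ refl
  lastOrInject₁ {suc n} Fin.zero    = inj₂ (Fin.zero , refl)
  lastOrInject₁ {suc n} (Fin.suc i) with lastOrInject₁ i
  ... | inj₁ i≡last     = inj₁ (cong Fin.suc i≡last)
  ... | inj₂ (i′ , i≡i′) = inj₂ (Fin.suc i′ , cong Fin.suc i≡i′)

cycle-twoNeighbours : ∀ {m} (R : Fin (3 + m) → Fin (3 + m) → Set) → (∀ {a b} → R a b → R b a) →
  (∀ (i : Fin (2 + m)) → R (inject₁ i) (Fin.suc i)) → R (fromℕ (2 + m)) Fin.zero →
  ∀ i → ∃₂ λ p q → p ≢ q × R i p × R i q
cycle-twoNeighbours R R-sym next close Fin.zero =
  Fin.suc Fin.zero , fromℕ _ , (λ ()) , next Fin.zero , R-sym close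
cycle-twoNeighbours {m} R R-sym next close (Fin.suc i) with lastOrInject₁ i
... | inj₁ refl = inject₁ (fromℕ (suc m)) , Fin.zero , (λ ()) , R-sym (next (fromℕ (suc m))) , close
... | inj₂ (i′ , refl) =
  inject₁ (inject₁ i′) , Fin.suc (Fin.suc i′) , before≢after ,
  R-sym (next (inject₁ i′)) , next (Fin.suc i′)
  where
  before≢after : inject₁ (inject₁ i′) ≢ Fin.suc (Fin.suc i′)
  before≢after = <⇒≢ (≤̄⇒inject₁< (<⇒≤ (≤̄⇒inject₁< {i = i′} ≤-refl)))

argmax : ∀ {n} (g : Fin (suc n) → ℕ) → ∃ λ i → ∀ j → g j ≤ g i
argmax {zero}  g = Fin.zero , λ { Fin.zero → ≤-refl }
argmax {suc n} g with argmax (g ∘ Fin.suc)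
... | i , max with g Fin.zero ≤? g (Fin.suc i)
...   | yes g₀≤ = Fin.suc i , λ { Fin.zero → g₀≤ ; (Fin.suc j) → max j }
...   | no g₀≰  = Fin.zero , λ { Fin.zero → ≤-refl ; (Fin.suc j) → ≤-trans (max j) (<⇒≤ (≰⇒> g₀≰)) }

module _ {n} (G : Graph n) (rank : Fin n → ℕ) where

  AtMostOneLowerNeighbour : Set
  AtMostOneLowerNeighbour = ∀ {x a b} → Adj G x a → Adj G x b → rank a ≤ rank x → rank b ≤ rank x → a ≡ b

  -- The vertex of maximal rank on a cycle has two distinct lower neighbours.
  atMostOneLowerNeighbour⇒acyclic : AtMostOneLowerNeighbour → ¬ HasCycle G
  atMostOneLowerNeighbour⇒acyclic unique (m , f , f-inj , next , close)
    with argmax (rank ∘ f)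
  ... | i , max with cycle-twoNeighbours (λ a b → Adj G (f a) (f b)) (sym G) next close i
  ...   | p , q , p≢q , ip , iq = p≢q (f-inj (unique ip iq (max p) (max q)))

maxRank-atMostOneNeighbour : ∀ {n} (G : Graph (suc n)) rank → AtMostOneLowerNeighbour G rank →
  ∃ λ u → AtMostOneNeighbour G u
maxRank-atMostOneNeighbour G rank unique =
  let (u , max) = argmax rank in u , λ ua ub → unique ua ub (max _) (max _)

induced : ∀ {n N} → Graph N → (Fin n → Fin N) → Graph n
induced G emb = record { Adj = λ a b → Adj G (emb a) (emb b) ; sym = sym G ; irrefl = irrefl G }

induced? : ∀ {n N} (G : Graph N) → DecidableAdj G → (emb : Fin n → Fin N) → DecidableAdj (induced G emb)
induced? G adj? emb a b = adj? (emb a) (emb b)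

deleteVertex? : ∀ {n} (G : Graph (suc n)) → DecidableAdj G → ∀ u → DecidableAdj (deleteVertex G u)
deleteVertex? G adj? u a b = adj? (punchIn u a) (punchIn u b)

induced-atMostOneLowerNeighbour : ∀ {n N} {G : Graph N} {rank} {emb : Fin n → Fin N} →
  Injective _≡_ _≡_ emb → AtMostOneLowerNeighbour G rank → AtMostOneLowerNeighbour (induced G emb) (rank ∘ emb)
induced-atMostOneLowerNeighbour emb-inj unique xa xb a≤x b≤x = emb-inj (unique xa xb a≤x b≤x)

sColorable-deleteVertex? : ∀ s {n} (G : Graph (suc n)) → DecidableAdj G →
  ∀ u j → Dec (SColorable s (deleteVertex G u) j)
sColorable-deleteVertex? s G adj? u = sColorable? s {G = deleteVertex G u} (deleteVertex? G adj? u)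

record CriticalInducedSubgraph (s : ℕ → ℕ) {N} (G : Graph N) (j : ℕ) : Set where
  field
    size                      : ℕ
    embedding                 : Fin (suc size) → Fin N
    embedding-injective       : Injective _≡_ _≡_ embedding
    nonColorable              : ¬ SColorable s (induced G embedding) j
    colorable-deleteVertex    : ∀ u → SColorable s (deleteVertex (induced G embedding) u) j

-- The recursion relies on deleteVertex (induced G emb) u being definitionally induced G (emb ∘ punchIn u).
criticalInducedSubgraph : ∀ (s : ℕ → ℕ) {N} {G : Graph N} → DecidableAdj G →
  ∀ j {n} (emb : Fin (suc n) → Fin N) → Injective _≡_ _≡_ emb → ¬ SColorable s (induced G emb) j → CriticalInducedSubgraph s G j
criticalInducedSubgraph s {G = G} adj? j {n} emb emb-inj ¬col
  with any? (λ u → ¬? (sColorable-deleteVertex? s (induced G emb) (induced? G adj? emb) u j))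
... | no none = record
  { embedding-injective    = emb-inj
  ; nonColorable           = ¬col
  ; colorable-deleteVertex = λ u →
      decidable-stable (sColorable-deleteVertex? s (induced G emb) (induced? G adj? emb) u j)
                       (λ ¬col-u → none (u , ¬col-u)) }
criticalInducedSubgraph s adj? j {zero}  emb emb-inj ¬col | yes (_ , ¬col-u) =
  ⊥-elim (¬col-u ((λ ()) , λ ()))
criticalInducedSubgraph s adj? j {suc n} emb emb-inj ¬col | yes (u , ¬col-u) =
  criticalInducedSubgraph s adj? j (emb ∘ punchIn u) (punchIn-injective u _ _ ∘ emb-inj) ¬col-u

IsParentOf : ∀ {n} → (Fin n → Fin n) → Fin n → Fin n → Set
IsParentOf parent a b = parent b ≡ a × a Fin.< b

parentGraph : ∀ {n} → (Fin n → Fin n) → Graph n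
parentGraph parent = record
  { Adj    = λ a b → IsParentOf parent a b ⊎ IsParentOf parent b a
  ; sym    = [ inj₂ , inj₁ ]′
  ; irrefl = λ { (inj₁ (_ , a<a)) → <-irrefl refl a<a ; (inj₂ (_ , a<a)) → <-irrefl refl a<a } }

parentGraph? : ∀ {n} (parent : Fin n → Fin n) → DecidableAdj (parentGraph parent)
parentGraph? parent a b = isParentOf? a b ⊎-dec isParentOf? b a
  where
  isParentOf? : ∀ a b → Dec (IsParentOf parent a b)
  isParentOf? a b = parent b Fin.≟ a ×-dec a <? b

parentGraph-atMostOneLowerNeighbour : ∀ {n} (parent : Fin n → Fin n) →
  AtMostOneLowerNeighbour (parentGraph parent) toℕ
parentGraph-atMostOneLowerNeighbour parent xa xb a≤x b≤x =
  ≡.trans (lower-isParent xa a≤x) (≡.sym (lower-isParent xb b≤x))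
  where
  lower-isParent : ∀ {x a} → Adj (parentGraph parent) x a → toℕ a ≤ toℕ x → a ≡ parent x
  lower-isParent (inj₁ (_ , x<a))      a≤x = ⊥-elim (<-irrefl refl (<-≤-trans x<a a≤x))
  lower-isParent (inj₂ (parent≡a , _)) _   = ≡.sym parent≡a

module CompleteTree₂ (m : ℕ) where

  Vertex : Set
  Vertex = Fin (suc (m + m * m))

  root : Vertex
  root = Fin.zero

  child : Fin m → Vertex
  child i = Fin.suc (i ↑ˡ m * m)

  grandchild : Fin m → Fin m → Vertex
  grandchild i j = Fin.suc (m ↑ʳ combine i j)

  parent : Vertex → Vertex
  parent Fin.zero    = root
  parent (Fin.suc x) = [ (λ _ → root) , (λ c → child (proj₁ (remQuot m c))) ]′ (splitAt m x)

  tree : Graph (suc (m + m * m))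
  tree = parentGraph parent

  root~child : ∀ i → Adj tree root (child i)
  root~child i = inj₁ (cong [ _ , _ ]′ (splitAt-↑ˡ m i (m * m)) , s≤s z≤n)

  child~grandchild : ∀ i j → Adj tree (child i) (grandchild i j)
  child~grandchild i j = inj₁ (parent≡ , s≤s child<grandchild)
    where
    parent≡ : parent (grandchild i j) ≡ child i
    parent≡ = begin
      [ _ , _ ]′ (splitAt m (m ↑ʳ combine i j))  ≡⟨ cong [ _ , _ ]′ (splitAt-↑ʳ m (m * m) (combine i j)) ⟩
      child (proj₁ (remQuot m (combine i j)))     ≡⟨ cong (child ∘ proj₁) (remQuot-combine i j) ⟩
      child i                                     ∎
      where open ≡-Reasoning
    child<grandchild : toℕ (i ↑ˡ m * m) < toℕ (m ↑ʳ combine i j)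
    child<grandchild = begin-strict
      toℕ (i ↑ˡ m * m)          ≡⟨ toℕ-↑ˡ i (m * m) ⟩
      toℕ i                     <⟨ toℕ<n i ⟩
      m                         ≤⟨ m≤m+n m _ ⟩
      m + toℕ (combine i j)     ≡⟨ toℕ-↑ʳ m (combine i j) ⟨
      toℕ (m ↑ʳ combine i j)    ∎
      where open ≤-Reasoning

  child-injective : Injective _≡_ _≡_ child
  child-injective = ↑ˡ-injective (m * m) _ _ ∘ suc-injective

  grandchild-injective : ∀ i → Injective _≡_ _≡_ (grandchild i)
  grandchild-injective i = combine-injectiveʳ i _ i _ ∘ ↑ʳ-injective m _ _ ∘ suc-injective

module _ {s : ℕ → ℕ} (S : PackingSequence s) (2≤s₂ : 2 ≤ s 2) (k : ℕ) where
  open CompleteTree₂ (suc k)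

  completeTree₂-nonColorable : ¬ SColorable s tree (suc k)
  completeTree₂-nonColorable (c , h)
    with star-hasColor₀ S 2≤s₂ h child child-injective root~child
  ... | i , cᵢ≡0 with star-hasColor₀ S 2≤s₂ h (grandchild i) (grandchild-injective i) (child~grandchild i)
  ...   | j , cᵢⱼ≡0 = adjacent-colors-differ s S h (child~grandchild i j) (≡.trans cᵢ≡0 (≡.sym cᵢⱼ≡0))

module _ (s : ℕ → ℕ) {N} {G : Graph N} (adj? : DecidableAdj G) {rank : Fin N → ℕ}
  (unique : AtMostOneLowerNeighbour G rank) {j} (C : CriticalInducedSubgraph s G j) where
  open CriticalInducedSubgraph C

  private
    T : Graph (suc size)
    T = induced G embedding

    T? : DecidableAdj T
    T? = induced? G adj? embedding

    T-unique : AtMostOneLowerNeighbour T (rank ∘ embedding)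
    T-unique = induced-atMostOneLowerNeighbour {G = G} embedding-injective unique

    colorable : SColorable s T (suc j)
    colorable = let (u , pendant) = maxRank-atMostOneNeighbour T _ T-unique in
      sColorable-extend-pendant T u pendant s (colorable-deleteVertex u)

    critical : ∀ u → ∃ λ i → i < suc j × ChiSIs s (deleteVertex T u) i
    critical u =
      let (i , i≤j , χ) = chiSIs-≤ s {G = deleteVertex T u} (deleteVertex? T T? u) (colorable-deleteVertex u)
      in i , s≤s i≤j , χ

  criticalInducedSubgraph⇒criticalTree : ∃ λ n → Σ (Graph (suc n)) λ T → IsTree T × IsCritical s T (suc j)
  criticalInducedSubgraph⇒criticalTree =
    size , T ,
    ( critical⇒connected s T? nonColorable colorable-deleteVertex
    , atMostOneLowerNeighbour⇒acyclic T _ T-unique ) ,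
    chiSIs-suc s colorable nonColorable , critical

mainTheorem7 : (k : ℕ) → 2 ≤ k → (s : ℕ → ℕ) → PackingSequence s → 2 ≤ s 2 →
    ∃ λ n → Σ (Graph (suc n)) λ T → IsTree T × IsCritical s T k
mainTheorem7 (suc (suc k)) (s≤s (s≤s _)) s S 2≤s₂ =
  criticalInducedSubgraph⇒criticalTree s tree? (parentGraph-atMostOneLowerNeighbour parent)
    (criticalInducedSubgraph s tree? (suc k) id id (completeTree₂-nonColorable S 2≤s₂ k))
  where
  open CompleteTree₂ (suc k) using (tree; parent)
  tree? : DecidableAdj tree
  tree? = parentGraph? parent
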